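{- Let $m,n$ be positive integers, $N=mn$, $c_{m,n}=\frac{(N-2)(n-1)}{2}$, and let $Y_{m,n}$ be the set of tuples $(\lambda_1,\dots,\lambda_N)\in\mathbb{Z}^N$ with $n-1\ge\lambda_1\ge\cdots\ge\lambda_N\ge 0$ and $\sum_i\lambda_i\equiv c_{m,n}\pmod n$. Let $\mathrm{shift}:\{0,\dots,n-1\}^N\to\{0,\dots,n-1\}^N$ be $\mathrm{shift}(x_1,\dots,x_N)=(x_1+1,\dots,x_N+1)$ with addition modulo $n$ (values taken in $\{0,\dots,n-1\}$), and let $\mathrm{sort}$ rearrange a tuple in nonincreasing order. Then for every $\lambda\in Y_{m,n}$, the set $\{\mathrm{sort}(\mathrm{shift}^j(\lambda)) : 0\le j\le n-1\}$ has exactly $n$ elements. -}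

module Defs where

open import Data.Nat using (ℕ; zero; suc; _+_; _*_; _∸_; _≤_; _<_; _≥_; NonZero)
open import Data.Nat.DivMod using (_/_; _%_)
open import Data.Nat.Properties using (≤-decTotalOrder)
open import Data.List using (List; []; _∷_; map; length)
open import Data.Nat.ListAction using (sum)
open import Data.List.Relation.Unary.All using (All)
open import Data.List.Relation.Unary.Linked using (Linked)
open import Relation.Binary.PropositionalEquality using (_≡_)
import Relation.Binary.Construct.Flip.EqAndOrd as Flip
import Data.List.Sort.InsertionSort.Base as IS

-- Tuples (λ₁,…,λ_N) ∈ ℤ^N with entries in {0,…,n-1} are represented as
-- lists of natural numbers of length N.

-- c_{m,n} = (N-2)(n-1)/2 with N = m n.  (This is always an integer; for
-- N = 1 we have n = 1 so c = 0, which is what truncated subtraction gives.)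
c : ℕ → ℕ → ℕ
c m n = ((m * n ∸ 2) * (n ∸ 1)) / 2

record InY (m n : ℕ) .{{_ : NonZero n}} (lam : List ℕ) : Set where
  field
    len      : length lam ≡ m * n
    bounded  : All (λ x → x < n) lam
    nonincr  : Linked _≥_ lam
    congr    : sum lam % n ≡ c m n % n

shift : (n : ℕ) .{{_ : NonZero n}} → List ℕ → List ℕ
shift n = map (λ x → suc x % n)

iter : {A : Set} → (A → A) → ℕ → A → A
iter f zero x = x
iter f (suc j) x = f (iter f j x)

sort : List ℕ → List ℕ
sort = IS.sort (Flip.decTotalOrder ≤-decTotalOrder)

-- If sort (shiftᵃ λ) = sort (shiftᵇ λ) with a < b, then μ = shiftᵃ λ is a permutation of its
-- rotation x ↦ (x + d) mod n, d = b − a ∈ (0, n).  A rotation moves an entry up by d or, if it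
-- wraps around, down by n − d.  Invariance of Σ x forces exactly m d wrap-arounds, and invariance
-- of Σ x² then yields 2 d Σ x ≡ m n d (n − d) (mod 2n).  Together with Σ x ≡ c_{m,n} (mod n) and
-- the evenness of d (d − 1) this reduces to n ∣ d, which is impossible.
module Submission where

open import Defs
open import Data.Nat using (ℕ; zero; suc; _+_; _*_; _∸_; _≤_; _<_; NonZero; s≤s; z≤n; >-nonZero⁻¹)
open import Data.Nat.Properties
open import Data.Nat.DivMod
open import Data.Nat.Divisibility using (_∣_; divides; ∣-trans; ∣m+n∣m⇒∣n; ∣m∣n⇒∣m+n; m∣m*n; n∣m*n; >⇒∤)
open import Data.Nat.ListAction using (sum)
open import Data.Nat.ListAction.Properties using (sum-↭)
open import Data.Nat.Tactic.RingSolver using (solve-∀)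
open import Data.Fin using (Fin; toℕ)
open import Data.Fin.Properties using (toℕ-injective; toℕ<n)
open import Data.List using (List; []; _∷_; map; length)
open import Data.List.Properties using (map-∘; map-cong; length-map)
open import Data.List.Relation.Unary.All using (All; []; _∷_; universal)
import Data.List.Relation.Unary.All.Properties as All
open import Data.List.Relation.Binary.Permutation.Propositional using (_↭_; ↭-sym; ↭-trans)
import Data.List.Relation.Binary.Permutation.Propositional.Properties as ↭
open import Data.Empty using (⊥; ⊥-elim)
open import Function.Definitions using (Injective)
open import Relation.Binary.Definitions using (tri<; tri≈; tri>)
open import Relation.Binary.PropositionalEquality
open import Relation.Nullary using (¬_)
import Relation.Binary.Construct.Flip.EqAndOrd as Flip
import Data.List.Sort.InsertionSort.Properties as InsertionSort

open ≡-Reasoning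

2∣n*[1+n] : ∀ n → 2 ∣ n * suc n
2∣n*[1+n] zero    = divides 0 refl
2∣n*[1+n] (suc n) = subst (2 ∣_) (step n) (∣m∣n⇒∣m+n (2∣n*[1+n] n) (n∣m*n (suc n)))
  where
  step : ∀ n → n * suc n + suc n * 2 ≡ suc n * suc (suc n)
  step = solve-∀

m<2⇒m*m≡m : ∀ {m} → m < 2 → m * m ≡ m
m<2⇒m*m≡m {zero}        _ = refl
m<2⇒m*m≡m {suc zero}    _ = refl
m<2⇒m*m≡m {suc (suc _)} (s≤s (s≤s ()))

c*2+n*2≡m*[1+n]*n : ∀ m n → 1 ≤ m → 1 ≤ n → c m (suc n) * 2 + n * 2 ≡ m * suc n * n
c*2+n*2≡m*[1+n]*n m n 1≤m 1≤n = begin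
  c m (suc n) * 2 + n * 2  ≡⟨ cong (_+ n * 2) (m/n*n≡m 2∣K*n) ⟩
  K * n + n * 2            ≡⟨ K*n+n*2≡m*[1+n]*n ⟩
  m * suc n * n            ∎
  where
  K = m * suc n ∸ 2

  K*n+n*2≡m*[1+n]*n : K * n + n * 2 ≡ m * suc n * n
  K*n+n*2≡m*[1+n]*n =
    trans (cong (K * n +_) (*-comm n 2)) (trans (sym (*-distribʳ-+ n K 2)) (cong (_* n) (m∸n+n≡m (*-mono-≤ 1≤m (s≤s 1≤n)))))

  regroup : ∀ m n → m * (n * suc n) ≡ m * suc n * n
  regroup = solve-∀

  2∣K*n : 2 ∣ K * n
  2∣K*n = ∣m+n∣m⇒∣n
    (subst (2 ∣_) (+-comm (K * n) (n * 2))
      (subst (2 ∣_) (sym K*n+n*2≡m*[1+n]*n)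
        (subst (2 ∣_) (regroup m n) (∣-trans (2∣n*[1+n] n) (n∣m*n m)))))
    (n∣m*n n)

-- The two moment equations combined, with S = r + qS n, c = r + qc n and d (d − 1) = 2e.
moments⇒n∣d-identity : ∀ m n-1 d-1 P r qS qc e → let n = suc n-1 ; d = suc d-1 in
  (d + d) * (r + qS * n) + m * n * (d * d) ≡ (n + n) * P + n * n * (m * d) →
  (r + qc * n) * 2 + n-1 * 2 ≡ m * n * n-1 →
  d-1 * d ≡ e * 2 →
  n * (m * e + d * qS) + d ≡ n * (P + d * qc + d)
moments⇒n∣d-identity m n-1 d-1 P r qS qc e second-moment c-spec d[d-1]-even =
  *-cancelʳ-≡ _ _ 2 (+-cancelʳ-≡ T _ _ (begin
    (n * (m * e + d * qS) + d) * 2 + T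
      ≡⟨ expand m n-1 d-1 P r qS qc e ⟩
    n * (P + d * qc + d) * 2
      + ((d + d) * (r + qS * n) + m * n * (d * d) + d * (m * n * n-1) + m * n * (e * 2))
      ≡⟨ cong (n * (P + d * qc + d) * 2 +_)
           (cong₂ _+_ (cong₂ _+_ second-moment (cong (d *_) (sym c-spec)))
                      (cong (m * n *_) (sym d[d-1]-even))) ⟩
    n * (P + d * qc + d) * 2 + T ∎))
  where
  n = suc n-1
  d = suc d-1
  T = (n + n) * P + n * n * (m * d) + d * ((r + qc * n) * 2 + n-1 * 2) + m * n * (d-1 * d)

  expand : ∀ m n-1 d-1 P r qS qc e → let n = suc n-1 ; d = suc d-1 in
    (n * (m * e + d * qS) + d) * 2
      + ((n + n) * P + n * n * (m * d) + d * ((r + qc * n) * 2 + n-1 * 2) + m * n * (d-1 * d))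
    ≡ n * (P + d * qc + d) * 2
      + ((d + d) * (r + qS * n) + m * n * (d * d) + d * (m * n * n-1) + m * n * (e * 2))
  expand = solve-∀

moments-contradiction : ∀ m n d S P .{{_ : NonZero n}} → 1 ≤ m → 0 < d → d < n →
  S % n ≡ c m n % n →
  (d + d) * S + m * n * (d * d) ≡ (n + n) * P + n * n * (m * d) → ⊥
moments-contradiction m n@(suc n-1) d@(suc d-1) S P 1≤m _ d<n S≡c second-moment =
  >⇒∤ d<n (∣m+n∣m⇒∣n (subst (n ∣_) (sym identity) (m∣m*n _)) (m∣m*n _))
  where
  r = c m n % n
  d[d-1]-even = 2∣n*[1+n] d-1
  e = _∣_.quotient d[d-1]-even

  S≡r+qS*n : S ≡ r + S / n * n
  S≡r+qS*n = trans (m≡m%n+[m/n]*n S n) (cong (_+ S / n * n) S≡c)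

  c-spec : (r + c m n / n * n) * 2 + n-1 * 2 ≡ m * n * n-1
  c-spec = subst (λ t → t * 2 + n-1 * 2 ≡ m * n * n-1) (m≡m%n+[m/n]*n (c m n) n)
    (c*2+n*2≡m*[1+n]*n m n-1 1≤m (≤-trans (s≤s z≤n) (≤-pred d<n)))

  identity : n * (m * e + d * (S / n)) + d ≡ n * (P + d * (c m n / n) + d)
  identity = moments⇒n∣d-identity m n-1 d-1 P r (S / n) (c m n / n) e
    (subst (λ t → (d + d) * t + m * n * (d * d) ≡ (n + n) * P + n * n * (m * d))
           S≡r+qS*n second-moment)
    c-spec (_∣_.equality d[d-1]-even)

module _ (n : ℕ) .{{_ : NonZero n}} where

  rotate : ℕ → ℕ → ℕ
  rotate d x = (x + d) % n

  carry : ℕ → ℕ → ℕ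
  carry d x = (x + d) / n

  carry*carry≡carry : ∀ {d x} → x < n → d < n → carry d x * carry d x ≡ carry d x
  carry*carry≡carry {d} {x} x<n d<n = m<2⇒m*m≡m (m<n*o⇒m/o<n {n = 2}
    (subst (x + d <_) (cong (n +_) (sym (+-identityʳ n))) (+-mono-< x<n d<n)))

  square-rotate : ∀ {d x} → x < n → d < n →
    x * x + (d + d) * x + d * d
      ≡ rotate d x * rotate d x + (n + n) * (carry d x * rotate d x) + n * n * carry d x
  square-rotate {d} {x} x<n d<n = begin
    x * x + (d + d) * x + d * d
      ≡⟨ square-+ x d ⟩
    (x + d) * (x + d)
      ≡⟨ cong (λ t → t * t) (m≡m%n+[m/n]*n (x + d) n) ⟩
    (r + w * n) * (r + w * n)
      ≡⟨ square-+* r w n ⟩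
    r * r + (n + n) * (w * r) + n * n * (w * w)
      ≡⟨ cong (λ t → r * r + (n + n) * (w * r) + n * n * t) (carry*carry≡carry x<n d<n) ⟩
    r * r + (n + n) * (w * r) + n * n * w ∎
    where
    r = rotate d x
    w = carry d x
    square-+ : ∀ x d → x * x + (d + d) * x + d * d ≡ (x + d) * (x + d)
    square-+ = solve-∀
    square-+* : ∀ r w n → (r + w * n) * (r + w * n) ≡ r * r + (n + n) * (w * r) + n * n * (w * w)
    square-+* = solve-∀

  sum-rotate : ∀ d xs → sum xs + length xs * d ≡ sum (map (rotate d) xs) + sum (map (carry d) xs) * n
  sum-rotate d []       = refl
  sum-rotate d (x ∷ xs) = begin
    x + sum xs + suc (length xs) * d
      ≡⟨ split x (sum xs) (length xs) d ⟩
    (x + d) + (sum xs + length xs * d)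
      ≡⟨ cong₂ _+_ (m≡m%n+[m/n]*n (x + d) n) (sum-rotate d xs) ⟩
    (rotate d x + carry d x * n) + (sum (map (rotate d) xs) + sum (map (carry d) xs) * n)
      ≡⟨ merge (rotate d x) (carry d x) (sum (map (rotate d) xs)) (sum (map (carry d) xs)) n ⟩
    rotate d x + sum (map (rotate d) xs) + (carry d x + sum (map (carry d) xs)) * n ∎
    where
    split : ∀ x s l d → x + s + suc l * d ≡ (x + d) + (s + l * d)
    split = solve-∀
    merge : ∀ a b c d n → (a + b * n) + (c + d * n) ≡ a + c + (b + d) * n
    merge = solve-∀

  sum-square-rotate : ∀ {d} xs → All (_< n) xs → d < n →
    sum (map (λ x → x * x) xs) + (d + d) * sum xs + length xs * (d * d)
      ≡ sum (map (λ x → rotate d x * rotate d x) xs)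
        + (n + n) * sum (map (λ x → carry d x * rotate d x) xs) + n * n * sum (map (carry d) xs)
  sum-square-rotate {d} [] [] _ = zeros (d + d) (n + n) (n * n)
    where
    zeros : ∀ a b c → 0 + a * 0 + 0 * c ≡ 0 + b * 0 + c * 0
    zeros = solve-∀
  sum-square-rotate {d} (x ∷ xs) (x<n ∷ xs<n) d<n = begin
    (x * x + Q) + (d + d) * (x + S) + suc (length xs) * (d * d)
      ≡⟨ split (x * x) Q (d + d) x S (length xs) (d * d) ⟩
    (x * x + (d + d) * x + d * d) + (Q + (d + d) * S + length xs * (d * d))
      ≡⟨ cong₂ _+_ (square-rotate x<n d<n) (sum-square-rotate xs xs<n d<n) ⟩
    (rotate d x * rotate d x + (n + n) * (carry d x * rotate d x) + n * n * carry d x)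
      + (Q′ + (n + n) * P + n * n * W)
      ≡⟨ merge (rotate d x * rotate d x) (carry d x * rotate d x) (carry d x) Q′ P W n ⟩
    (rotate d x * rotate d x + Q′) + (n + n) * (carry d x * rotate d x + P)
      + n * n * (carry d x + W) ∎
    where
    S  = sum xs
    Q  = sum (map (λ x → x * x) xs)
    Q′ = sum (map (λ x → rotate d x * rotate d x) xs)
    P  = sum (map (λ x → carry d x * rotate d x) xs)
    W  = sum (map (carry d) xs)
    split : ∀ a b c x s l e → (a + b) + c * (x + s) + suc l * e ≡ (a + c * x + e) + (b + c * s + l * e)
    split = solve-∀
    merge : ∀ a b c a′ b′ c′ n → (a + (n + n) * b + n * n * c) + (a′ + (n + n) * b′ + n * n * c′)
      ≡ (a + a′) + (n + n) * (b + b′) + n * n * (c + c′)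
    merge = solve-∀

  sum-rotate-% : ∀ m d xs → length xs ≡ m * n → sum (map (rotate d) xs) % n ≡ sum xs % n
  sum-rotate-% m d xs len = begin
    sum (map (rotate d) xs) % n
      ≡⟨ [m+kn]%n≡m%n _ (sum (map (carry d) xs)) n ⟨
    (sum (map (rotate d) xs) + sum (map (carry d) xs) * n) % n
      ≡⟨ cong (_% n) (sum-rotate d xs) ⟨
    (sum xs + length xs * d) % n
      ≡⟨ cong (λ t → (sum xs + t) % n) (trans (cong (_* d) len) (swap m n d)) ⟩
    (sum xs + m * d * n) % n
      ≡⟨ [m+kn]%n≡m%n (sum xs) (m * d) n ⟩
    sum xs % n ∎
    where
    swap : ∀ m n d → m * n * d ≡ m * d * n
    swap = solve-∀

  module _ {d : ℕ} {μ : List ℕ} (μ↭rotμ : μ ↭ map (rotate d) μ) where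

    ↭-rotate⇒length*d≡carries*n : length μ * d ≡ sum (map (carry d) μ) * n
    ↭-rotate⇒length*d≡carries*n = +-cancelˡ-≡ (sum μ) _ _ (begin
      sum μ + length μ * d                                   ≡⟨ sum-rotate d μ ⟩
      sum (map (rotate d) μ) + sum (map (carry d) μ) * n    ≡⟨ cong (_+ sum (map (carry d) μ) * n) (sum-↭ μ↭rotμ) ⟨
      sum μ + sum (map (carry d) μ) * n                      ∎)

    ↭-rotate⇒second-moment : All (_< n) μ → d < n →
      (d + d) * sum μ + length μ * (d * d)
        ≡ (n + n) * sum (map (λ x → carry d x * rotate d x) μ) + n * n * sum (map (carry d) μ)
    ↭-rotate⇒second-moment μ<n d<n = +-cancelˡ-≡ Q _ _ (begin
      Q + ((d + d) * sum μ + length μ * (d * d))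
        ≡⟨ +-assoc Q _ _ ⟨
      Q + (d + d) * sum μ + length μ * (d * d)
        ≡⟨ sum-square-rotate μ μ<n d<n ⟩
      Q′ + (n + n) * P + n * n * W
        ≡⟨ cong (λ t → t + (n + n) * P + n * n * W) Q′≡Q ⟩
      Q + (n + n) * P + n * n * W
        ≡⟨ +-assoc Q _ _ ⟩
      Q + ((n + n) * P + n * n * W) ∎)
      where
      Q  = sum (map (λ x → x * x) μ)
      Q′ = sum (map (λ x → rotate d x * rotate d x) μ)
      P  = sum (map (λ x → carry d x * rotate d x) μ)
      W  = sum (map (carry d) μ)
      Q′≡Q : Q′ ≡ Q
      Q′≡Q = sym (trans (sum-↭ (↭.map⁺ (λ x → x * x) μ↭rotμ)) (cong sum (sym (map-∘ μ))))

-- Y without the monotonicity condition; unlike Y it is closed under shift.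
record Admissible (m n : ℕ) .{{_ : NonZero n}} (xs : List ℕ) : Set where
  field
    len     : length xs ≡ m * n
    bounded : All (_< n) xs
    congr   : sum xs % n ≡ c m n % n

InY⇒Admissible : ∀ {m n} .{{_ : NonZero n}} {lam} → InY m n lam → Admissible m n lam
InY⇒Admissible y = record { len = InY.len y ; bounded = InY.bounded y ; congr = InY.congr y }

iter-+ : ∀ {A : Set} (g : A → A) i j x → iter g (i + j) x ≡ iter g i (iter g j x)
iter-+ g zero    j x = refl
iter-+ g (suc i) j x = cong g (iter-+ g i j x)

suc[m%n]%n≡suc[m]%n : ∀ m n .{{_ : NonZero n}} → suc (m % n) % n ≡ suc m % n
suc[m%n]%n≡suc[m]%n m n = begin
  suc (m % n) % n                ≡⟨ [m+kn]%n≡m%n (suc (m % n)) (m / n) n ⟨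
  suc (m % n + m / n * n) % n    ≡⟨ cong (λ t → suc t % n) (m≡m%n+[m/n]*n m n) ⟨
  suc m % n                      ∎

module _ {n : ℕ} .{{_ : NonZero n}} where

  iter-shift : ∀ k xs → iter (shift n) (suc k) xs ≡ map (rotate n (suc k)) xs
  iter-shift zero    xs = map-cong (λ x → cong (_% n) (+-comm 1 x)) xs
  iter-shift (suc k) xs = begin
    shift n (iter (shift n) (suc k) xs)                ≡⟨ cong (shift n) (iter-shift k xs) ⟩
    map (λ y → suc y % n) (map (rotate n (suc k)) xs)  ≡⟨ map-∘ xs ⟨
    map (λ x → suc ((x + suc k) % n) % n) xs           ≡⟨ map-cong rotate-suc xs ⟩
    map (rotate n (suc (suc k))) xs                    ∎
    where
    rotate-suc : ∀ x → suc ((x + suc k) % n) % n ≡ (x + suc (suc k)) % n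
    rotate-suc x = trans (suc[m%n]%n≡suc[m]%n (x + suc k) n) (cong (_% n) (sym (+-suc x (suc k))))

  Admissible-iter-shift : ∀ {m} k {xs} → Admissible m n xs → Admissible m n (iter (shift n) k xs)
  Admissible-iter-shift zero    a = a
  Admissible-iter-shift {m} (suc k) {xs} a rewrite iter-shift k xs = record
    { len     = trans (length-map _ xs) (Admissible.len a)
    ; bounded = All.map⁺ (universal (λ x → m%n<n (x + suc k) n) xs)
    ; congr   = trans (sum-rotate-% n m (suc k) xs (Admissible.len a)) (Admissible.congr a)
    }

rotation-free : ∀ {m n d μ} .{{_ : NonZero n}} → 1 ≤ m → Admissible m n μ → 0 < d → d < n →
  ¬ (μ ↭ map (rotate n d) μ)
rotation-free {m} {n} {d} {μ} 1≤m a 0<d d<n μ↭rotμ =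
  moments-contradiction m n d (sum μ) P 1≤m 0<d d<n congr second-moment
  where
  open Admissible a
  P = sum (map (λ x → carry n d x * rotate n d x) μ)
  W = sum (map (carry n d) μ)

  W≡m*d : W ≡ m * d
  W≡m*d = *-cancelʳ-≡ W (m * d) n (sym (begin
    m * d * n    ≡⟨ swap m d n ⟩
    m * n * d    ≡⟨ cong (_* d) len ⟨
    length μ * d ≡⟨ ↭-rotate⇒length*d≡carries*n n μ↭rotμ ⟩
    W * n        ∎))
    where
    swap : ∀ m d n → m * d * n ≡ m * n * d
    swap = solve-∀

  second-moment : (d + d) * sum μ + m * n * (d * d) ≡ (n + n) * P + n * n * (m * d)
  second-moment = subst₂ (λ l w → (d + d) * sum μ + l * (d * d) ≡ (n + n) * P + n * n * w)
    len W≡m*d (↭-rotate⇒second-moment n μ↭rotμ bounded d<n)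

sort-≡⇒↭ : ∀ {xs ys} → sort xs ≡ sort ys → xs ↭ ys
sort-≡⇒↭ {xs} {ys} eq =
  ↭-trans (↭-sym (sort-↭ xs)) (subst (_↭ ys) (sym eq) (sort-↭ ys))
  where open InsertionSort (Flip.decTotalOrder ≤-decTotalOrder) using (sort-↭)

sort-iter-shift-< : ∀ {m n a b} .{{_ : NonZero n}} {lam} → 1 ≤ m → InY m n lam → a < b → b < n →
  sort (iter (shift n) a lam) ≡ sort (iter (shift n) b lam) → ⊥
sort-iter-shift-< {m} {n} {a} {b} {lam} 1≤m y a<b b<n eq =
  rotation-free 1≤m (Admissible-iter-shift a (InY⇒Admissible y)) (s≤s z≤n) d<n
    (subst (μ ↭_) shiftᵇ≡rotμ (sort-≡⇒↭ eq))
  where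
  k  = b ∸ suc a
  μ  = iter (shift n) a lam
  b≡[1+k]+a : b ≡ suc k + a
  b≡[1+k]+a = trans (sym (m∸n+n≡m a<b)) (+-suc k a)
  d<n : suc k < n
  d<n = ≤-<-trans (s≤s (m≤m+n k a)) (subst (_< n) b≡[1+k]+a b<n)
  shiftᵇ≡rotμ : iter (shift n) b lam ≡ map (rotate n (suc k)) μ
  shiftᵇ≡rotμ = begin
    iter (shift n) b lam             ≡⟨ cong (λ t → iter (shift n) t lam) b≡[1+k]+a ⟩
    iter (shift n) (suc k + a) lam   ≡⟨ iter-+ (shift n) (suc k) a lam ⟩
    iter (shift n) (suc k) μ         ≡⟨ iter-shift k μ ⟩
    map (rotate n (suc k)) μ         ∎

lemma3p1 : (m n : ℕ) → .{{_ : NonZero m}} → .{{_ : NonZero n}} → (lam : List ℕ) → InY m n lam →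
    Injective _≡_ _≡_ (λ (j : Fin n) → sort (iter (shift n) (toℕ j) lam))
lemma3p1 m n lam y {i} {j} eq with <-cmp (toℕ i) (toℕ j)
... | tri< i<j _ _ = ⊥-elim (sort-iter-shift-< (>-nonZero⁻¹ m) y i<j (toℕ<n j) eq)
... | tri≈ _ i≡j _ = toℕ-injective i≡j
... | tri> _ _ j<i = ⊥-elim (sort-iter-shift-< (>-nonZero⁻¹ m) y j<i (toℕ<n i) (sym eq))
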